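{- Let $\approx$ be an equinumerosity on the family $\mathbf F$ of point sets over $\mathbb N$, let $\mathfrak N=\mathbf F/\!\approx$ be its set of numerosities and $\mathfrak n:\mathbf F\to\mathfrak N$ the canonical map. Then there exist unique operations $+$ and $\cdot$ and a unique linear order $<$ on $\mathfrak N$ such that for all point sets $A,B$: (1) $\mathfrak n(A)+\mathfrak n(B)=\mathfrak n(A\cup B)$ whenever $A,B\subseteq\mathbb N^k$ for the same $k$ and $A\cap B=\emptyset$; (2) $\mathfrak n(A)\cdot\mathfrak n(B)=\mathfrak n(A\times B)$; (3) $\mathfrak n(A)<\mathfrak n(B)$ iff $A\approx B'$ for some proper subset $B'\subset B$. The resulting structure on $\mathfrak N$ is the non-negative part of a discretely ordered (not necessarily commutative) ring $(\mathfrak R,0,1,+,\cdot,<)$. Moreover, if the fundamental subring of $\mathfrak R$ is identified with $\mathbb Z$, then $\mathfrak n(A)=|A|$ for every finite point set $A$.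
   Context: $\mathbb N=\{0,1,2,\dots\}$. $\mathbf F=\bigcup_{k\ge1}\mathcal P(\mathbb N^k)$ is the family of point sets. Cartesian products are identified with concatenations: for $A\subseteq\mathbb N^k$, $B\subseteq\mathbb N^h$, $A\times B=\{(a_1,\dots,a_k,b_1,\dots,b_h): (a_1,\dots,a_k)\in A,(b_1,\dots,b_h)\in B\}\subseteq\mathbb N^{k+h}$. An equinumerosity is an equivalence relation $\approx$ on $\mathbf F$ such that for all point sets $A,B,A',B'$: (E1) $A\approx B$ iff $A\setminus B\approx B\setminus A$; (E2) exactly one of: (a) $A\approx B$; (b) $A'\approx B$ for some proper subset $A'\subset A$; (c) $A\approx B'$ for some proper subset $B'\subset B$; (E3) $A\times\{P\}\approx\{P\}\times A\approx A$ for every point $P$ (element of some $\mathbb N^h$); (E4) $A\approx A'$ and $B\approx B'$ imply $A\times B\approx A'\times B'$. -}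

module Defs where

open import Level using (Level; 0ℓ; _⊔_) renaming (suc to lsuc)
open import Data.Nat using (ℕ; zero; suc) renaming (_+_ to _+ℕ_)
open import Data.Vec using (Vec; _++_)
open import Data.List using (List; length)
open import Data.List.Relation.Unary.Unique.Propositional using (Unique)
import Data.List.Membership.Propositional as LMem
open import Data.Product using (Σ; ∃; _×_; _,_)
open import Data.Sum using (_⊎_)
open import Data.Empty using (⊥)
open import Relation.Nullary using (¬_)
open import Relation.Binary.PropositionalEquality using (_≡_; subst)
open import Relation.Binary.Structures using (IsEquivalence; IsStrictTotalOrder)
open import Function.Bundles using (_⇔_)
open import Algebra.Bundles using (Ring)

-- A point set is a subset of ℕ^k for some k ≥ 1; we tag it
-- with its ambient dimension k = suc dim and give it as a predicate.
-- Sets are compared extensionally through the tag-independent membership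
-- _∈ₚ_ (a tuple of the wrong length is never a member), so e.g. the empty
-- sets of different dimensions are equal as sets (_≐_).

record PSet : Set₁ where
  constructor pset
  field
    dim : ℕ
    mem : Vec ℕ (suc dim) → Set
open PSet public

_∈ₚ_ : ∀ {n} → Vec ℕ n → PSet → Set
_∈ₚ_ {n} x A = Σ (n ≡ suc (dim A)) λ e → mem A (subst (Vec ℕ) e x)

_⊆_ : PSet → PSet → Set
A ⊆ B = ∀ {n} (x : Vec ℕ n) → x ∈ₚ A → x ∈ₚ B

_≐_ : PSet → PSet → Set
A ≐ B = (A ⊆ B) × (B ⊆ A)

_⊂_ : PSet → PSet → Set
A ⊂ B = (A ⊆ B) × ¬ (B ⊆ A)

_∖_ : PSet → PSet → PSet
A ∖ B = pset (dim A) (λ x → mem A x × ¬ (x ∈ₚ B))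

-- union; it is the set-theoretic union A ∪ B when dim A ≡ dim B
-- (the only situation in which it is used)
_∪_ : PSet → PSet → PSet
A ∪ B = pset (dim A) (λ x → mem A x ⊎ x ∈ₚ B)

Disjoint : PSet → PSet → Set
Disjoint A B = ∀ {n} (x : Vec ℕ n) → x ∈ₚ A → x ∈ₚ B → ⊥


-- Cartesian product, identified with concatenation of tuples
_⊗_ : PSet → PSet → PSet
A ⊗ B = pset (dim A +ℕ suc (dim B))
  (λ z → Σ (Vec ℕ (suc (dim A))) λ x → Σ (Vec ℕ (suc (dim B))) λ y →
           (z ≡ x ++ y) × mem A x × mem B y)

｛_｝ : ∀ {h} → Vec ℕ (suc h) → PSet
｛_｝ {h} P = pset h (λ x → x ≡ P)

HasCard : PSet → ℕ → Set
HasCard A m = Σ (List (Vec ℕ (suc (dim A)))) λ xs →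
  (length xs ≡ m) × Unique xs × (∀ x → mem A x ⇔ (x LMem.∈ xs))

ExactlyOne : ∀ {a b c} → Set a → Set b → Set c → Set (a ⊔ b ⊔ c)
ExactlyOne P Q R = (P ⊎ (Q ⊎ R)) × ¬ (P × Q) × ¬ (P × R) × ¬ (Q × R)

record IsEquinumerosity (_≈_ : PSet → PSet → Set) : Set₁ where
  field
    isEquivalence : IsEquivalence _≈_
    -- ≈ is a relation on *sets*: extensionally equal point sets are related
    ext : ∀ {A B} → A ≐ B → A ≈ B
    E1 : ∀ A B → (A ≈ B) ⇔ ((A ∖ B) ≈ (B ∖ A))
    E2 : ∀ A B → ExactlyOne (A ≈ B)
                            (Σ PSet λ A' → (A' ⊂ A) × (A' ≈ B))
                            (Σ PSet λ B' → (B' ⊂ B) × (A ≈ B'))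
    E3 : ∀ A {h} (P : Vec ℕ (suc h)) → ((A ⊗ ｛ P ｝) ≈ A) × ((｛ P ｝ ⊗ A) ≈ A)
    E4 : ∀ {A A' B B'} → A ≈ A' → B ≈ B' → (A ⊗ B) ≈ (A' ⊗ B')

-- Operations / relations on numerosities 𝔑 = F/≈, represented on
-- representatives (setoid style): an operation on 𝔑 is a ≈-congruent
-- operation on point sets, and equality in 𝔑 is ≈.

module _ (_≈_ : PSet → PSet → Set) where

  Congruent≈ : (PSet → PSet → PSet) → Set₁
  Congruent≈ _∙_ = ∀ {A A' B B'} → A ≈ A' → B ≈ B' → (A ∙ B) ≈ (A' ∙ B')

  Respects≈ : (PSet → PSet → Set) → Set₁
  Respects≈ _≺_ = ∀ {A A' B B'} → A ≈ A' → B ≈ B' → A ≺ B → A' ≺ B'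

  IsNumSum : (PSet → PSet → PSet) → Set₁
  IsNumSum _⊕_ = Congruent≈ _⊕_ ×
    (∀ A B → dim A ≡ dim B → Disjoint A B → (A ⊕ B) ≈ (A ∪ B))

  IsNumProd : (PSet → PSet → PSet) → Set₁
  IsNumProd _⊙_ = Congruent≈ _⊙_ × (∀ A B → (A ⊙ B) ≈ (A ⊗ B))

  IsNumOrder : (PSet → PSet → Set) → Set₁
  IsNumOrder _≺_ = Respects≈ _≺_ ×
    (∀ A B → (A ≺ B) ⇔ (Σ PSet λ B' → (B' ⊂ B) × (A ≈ B')))

module _ {c ℓ} (R : Ring c ℓ) where
  open Ring R

  record IsDiscretelyOrderedRing {ℓ'} (_<_ : Carrier → Carrier → Set ℓ') :
         Set (c ⊔ ℓ ⊔ ℓ') where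
    field
      isStrictTotalOrder : IsStrictTotalOrder _≈_ _<_
      +-mono-< : ∀ {a b} c → a < b → (a + c) < (b + c)
      *-pos    : ∀ {a b} → 0# < a → 0# < b → 0# < (a * b)
      discrete : ∀ a → 0# < a → ¬ (a < 1#)

  -- image of n ∈ ℕ in the fundamental subring: 1 + 1 + ... + 1
  natR : ℕ → Carrier
  natR zero    = 0#
  natR (suc n) = 1# + natR n

module Submission where

-- A + B is realised by disjoint copies of A and B, tagged by a leading coordinate 0 resp. 1 and
-- padded with zeros to a common dimension. By (E3) each copy is equinumerous to the original, and
-- since by (E1) equinumerosity only depends on the differences A ∖ B and B ∖ A, disjoint parts of a
-- union may be exchanged for equinumerous ones and cancelled. Hence the numerosities form a
-- cancellative commutative monoid over which × distributes, and their formal differences form the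
-- ring ℜ. Putting A below B when B ≈ A + C for a non-empty C agrees with (3), because B ≈ B' + (B ∖ B')
-- whenever B' ⊆ B, and (E2) makes it total. It is discrete: if a ∈ A and 1 ≈ A + C then
-- 1 ≈ 1 + (A ∖ {a}) + C, leaving a non-empty set of numerosity 0. Likewise a set with m elements
-- splits into m singletons, each of numerosity 1. Excluded middle is used to split sets and to
-- squash the order into Set.

open import Defs
open import Level using (0ℓ; Lift; lift; lower) renaming (suc to lsuc)
open import Data.Nat using (ℕ; zero; suc; _+_)
open import Data.Nat.Properties using (+-suc; +-comm; +-assoc; suc-injective; +-commutativeSemigroup)
open import Data.Vec using (Vec; []; _∷_; _++_; [_]; replicate)
open import Data.Vec.Properties using (++-injectiveˡ; ++-injectiveʳ; ++-assoc-eqFree; subst-is-cast; cast-sym)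
open import Data.Product using (Σ; _×_; _,_; proj₁; proj₂)
open import Data.Sum using (_⊎_; inj₁; inj₂)
open import Data.Empty using (⊥; ⊥-elim)
open import Data.List using ([]; _∷_)
open import Data.List.Membership.Propositional using (_∈_)
open import Data.List.Relation.Unary.Any using (here; there)
import Data.List.Relation.Unary.All as All
open import Data.List.Relation.Unary.AllPairs using (_∷_)
open import Relation.Nullary using (¬_; Dec; yes; no)
open import Relation.Nullary.Decidable using (True; toWitness; fromWitness; map′)
open import Relation.Binary.Definitions using (Tri; tri<; tri≈; tri>)
open import Relation.Binary.PropositionalEquality using (_≡_; refl; sym; trans; cong; subst)
open import Relation.Binary.Structures using (IsEquivalence; IsStrictTotalOrder)
open import Axiom.ExcludedMiddle using (ExcludedMiddle)
open import Function.Bundles using (_⇔_; mk⇔; Equivalence)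
open import Function using (case_of_)
open import Algebra.Properties.CommutativeSemigroup +-commutativeSemigroup using (x∙yz≈y∙xz)
open import Algebra.Structures using (IsCommutativeMonoid)
open import Algebra.Bundles using (CommutativeMonoid; Ring)
import Algebra.Properties.CommutativeSemigroup as CommutativeSemigroupProperties

≐-sym : ∀ {A B} → A ≐ B → B ≐ A
≐-sym (f , g) = g , f

∅ : PSet
∅ = pset 0 (λ _ → ⊥)

IsEmpty : PSet → Set
IsEmpty A = ∀ {n} (x : Vec ℕ n) → ¬ (x ∈ₚ A)

NonEmpty : PSet → Set
NonEmpty A = Σ ℕ λ n → Σ (Vec ℕ n) λ x → x ∈ₚ A

∅-isEmpty : IsEmpty ∅
∅-isEmpty x (_ , ())

isEmpty⇒≐ : ∀ {A B} → IsEmpty A → IsEmpty B → A ≐ B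
isEmpty⇒≐ eA eB = (λ x p → ⊥-elim (eA x p)) , (λ x p → ⊥-elim (eB x p))

Disjoint-sym : ∀ {X Y} → Disjoint X Y → Disjoint Y X
Disjoint-sym d x p q = d x q p

Disjoint-∪ˡ : ∀ X Y W → Disjoint X W → Disjoint Y W → Disjoint (X ∪ Y) W
Disjoint-∪ˡ (pset k P) Y W dX dY x (refl , inj₁ p) w = dX x (refl , p) w
Disjoint-∪ˡ (pset k P) Y W dX dY x (refl , inj₂ q) w = dY x q w

∈-∪ʳ : ∀ X Y {n} (x : Vec ℕ n) → dim X ≡ dim Y → x ∈ₚ Y → x ∈ₚ (X ∪ Y)
∈-∪ʳ (pset k P) (pset .k Q) x refl (refl , q) = refl , inj₂ (refl , q)

∈-⊗ : ∀ X Y {m n} (x : Vec ℕ m) (y : Vec ℕ n) → x ∈ₚ X → y ∈ₚ Y → (x ++ y) ∈ₚ (X ⊗ Y)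
∈-⊗ (pset k P) (pset l Q) x y (refl , p) (refl , q) = refl , (x , y , refl , p , q)

∪-comm : ∀ X Y → dim X ≡ dim Y → (X ∪ Y) ≐ (Y ∪ X)
∪-comm (pset k P) (pset .k Q) refl = swap P Q , swap Q P
  where
  swap : ∀ R S → (pset k R ∪ pset k S) ⊆ (pset k S ∪ pset k R)
  swap R S x (refl , inj₁ p) = refl , inj₂ (refl , p)
  swap R S x (refl , inj₂ (refl , q)) = refl , inj₁ q

∪-assoc : ∀ X Y W → dim X ≡ dim Y → dim Y ≡ dim W → ((X ∪ Y) ∪ W) ≐ (X ∪ (Y ∪ W))
∪-assoc (pset k P) (pset .k Q) (pset .k R) refl refl = f , g
  where
  f : ((pset k P ∪ pset k Q) ∪ pset k R) ⊆ (pset k P ∪ (pset k Q ∪ pset k R))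
  f x (refl , inj₁ (inj₁ p)) = refl , inj₁ p
  f x (refl , inj₁ (inj₂ (refl , q))) = refl , inj₂ (refl , inj₁ q)
  f x (refl , inj₂ (refl , r)) = refl , inj₂ (refl , inj₂ (refl , r))
  g : (pset k P ∪ (pset k Q ∪ pset k R)) ⊆ ((pset k P ∪ pset k Q) ∪ pset k R)
  g x (refl , inj₁ p) = refl , inj₁ (inj₁ p)
  g x (refl , inj₂ (refl , inj₁ q)) = refl , inj₁ (inj₂ (refl , q))
  g x (refl , inj₂ (refl , inj₂ (refl , r))) = refl , inj₂ (refl , r)

∪-identityʳ : ∀ X E → IsEmpty E → (X ∪ E) ≐ X
∪-identityʳ (pset k P) E eE = f , g
  where
  f : (pset k P ∪ E) ⊆ pset k P
  f x (refl , inj₁ p) = refl , p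
  f x (refl , inj₂ q) = ⊥-elim (eE x q)
  g : pset k P ⊆ (pset k P ∪ E)
  g x (refl , p) = refl , inj₁ p

∖-∪-cancelˡ : ∀ C X Y → dim X ≡ dim C → Disjoint X C → (X ∖ Y) ≐ ((C ∪ X) ∖ (C ∪ Y))
∖-∪-cancelˡ (pset k P) (pset .k Q) Y refl d = f , g
  where
  f : (pset k Q ∖ Y) ⊆ ((pset k P ∪ pset k Q) ∖ (pset k P ∪ Y))
  f x (refl , (q , ny)) = refl , (inj₂ (refl , q) , notInC∪Y)
    where
    notInC∪Y : ¬ (x ∈ₚ (pset k P ∪ Y))
    notInC∪Y (refl , inj₁ c) = d x (refl , q) (refl , c)
    notInC∪Y (refl , inj₂ y) = ny y
  g : ((pset k P ∪ pset k Q) ∖ (pset k P ∪ Y)) ⊆ (pset k Q ∖ Y)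
  g x (refl , (inj₁ c , n)) = ⊥-elim (n (refl , inj₁ c))
  g x (refl , (inj₂ (refl , q) , n)) = refl , (q , λ y → n (refl , inj₂ y))

⊗-distribʳ-∪ : ∀ X Y Q → dim X ≡ dim Y → ((X ∪ Y) ⊗ Q) ≐ ((X ⊗ Q) ∪ (Y ⊗ Q))
⊗-distribʳ-∪ (pset k P) (pset .k R) Q refl = f , g
  where
  f : ((pset k P ∪ pset k R) ⊗ Q) ⊆ ((pset k P ⊗ Q) ∪ (pset k R ⊗ Q))
  f z (refl , (x , q , eq , inj₁ p , mq)) = refl , inj₁ (x , q , eq , p , mq)
  f z (refl , (x , q , eq , inj₂ (refl , r) , mq)) = refl , inj₂ (refl , (x , q , eq , r , mq))
  g : ((pset k P ⊗ Q) ∪ (pset k R ⊗ Q)) ⊆ ((pset k P ∪ pset k R) ⊗ Q)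
  g z (refl , inj₁ (x , q , eq , p , mq)) = refl , (x , q , eq , inj₁ p , mq)
  g z (refl , inj₂ (refl , (x , q , eq , r , mq))) = refl , (x , q , eq , inj₂ (refl , r) , mq)

⊗-distribˡ-∪ : ∀ X Y P → dim X ≡ dim Y → (P ⊗ (X ∪ Y)) ≐ ((P ⊗ X) ∪ (P ⊗ Y))
⊗-distribˡ-∪ (pset k R₁) (pset .k R₂) P refl = f , g
  where
  f : (P ⊗ (pset k R₁ ∪ pset k R₂)) ⊆ ((P ⊗ pset k R₁) ∪ (P ⊗ pset k R₂))
  f z (refl , (p , x , eq , mp , inj₁ r)) = refl , inj₁ (p , x , eq , mp , r)
  f z (refl , (p , x , eq , mp , inj₂ (refl , r))) = refl , inj₂ (refl , (p , x , eq , mp , r))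
  g : ((P ⊗ pset k R₁) ∪ (P ⊗ pset k R₂)) ⊆ (P ⊗ (pset k R₁ ∪ pset k R₂))
  g z (refl , inj₁ (p , x , eq , mp , r)) = refl , (p , x , eq , mp , inj₁ r)
  g z (refl , inj₂ (refl , (p , x , eq , mp , r))) = refl , (p , x , eq , mp , inj₂ (refl , r))

⊗-disjointʳ : ∀ X Y Q → dim X ≡ dim Y → Disjoint X Y → Disjoint (X ⊗ Q) (Y ⊗ Q)
⊗-disjointʳ (pset k P) (pset .k R) Q refl d z (refl , (x , q , eq , mx , mq)) (refl , (y , q' , eq' , my , mq')) =
  d x (refl , mx) (subst (λ v → v ∈ₚ pset k R) (sym (++-injectiveˡ x y (trans (sym eq) eq'))) (refl , my))

⊗-disjointˡ : ∀ X Y P → dim X ≡ dim Y → Disjoint X Y → Disjoint (P ⊗ X) (P ⊗ Y)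
⊗-disjointˡ (pset k R₁) (pset .k R₂) P refl d z (refl , (p , x , eq , mp , mx)) (refl , (p' , y , eq' , mp' , my)) =
  d x (refl , mx) (subst (λ v → v ∈ₚ pset k R₂) (sym (++-injectiveʳ p p' (trans (sym eq) eq'))) (refl , my))

⊗-assoc-≐ : ∀ A B C → ((A ⊗ B) ⊗ C) ≐ (A ⊗ (B ⊗ C))
⊗-assoc-≐ (pset a P) (pset b Q) (pset c R) = f , g
  where
  e : (suc a + suc b) + suc c ≡ suc a + (suc b + suc c)
  e = +-assoc (suc a) (suc b) (suc c)
  f : ((pset a P ⊗ pset b Q) ⊗ pset c R) ⊆ (pset a P ⊗ (pset b Q ⊗ pset c R))
  f z (refl , (u , w , refl , (x , y , refl , px , qy) , rw)) =
    e , (x , y ++ w , trans (subst-is-cast e _) (++-assoc-eqFree x y w) , px , (y , w , refl , qy , rw))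
  g : (pset a P ⊗ (pset b Q ⊗ pset c R)) ⊆ ((pset a P ⊗ pset b Q) ⊗ pset c R)
  g z (refl , (x , v , refl , px , (y , w , refl , qy , rw))) =
    sym e , (x ++ y , w , trans (subst-is-cast (sym e) _) (cast-sym e (++-assoc-eqFree x y w)) , (x , y , refl , px , qy) , rw)

⊗-isEmptyʳ : ∀ A E → IsEmpty E → IsEmpty (A ⊗ E)
⊗-isEmptyʳ (pset a P) (pset k Q) eE z (refl , (x , y , eq , px , qy)) = eE y (refl , qy)

⊗-isEmptyˡ : ∀ A E → IsEmpty E → IsEmpty (E ⊗ A)
⊗-isEmptyˡ (pset a P) (pset k Q) eE z (refl , (y , x , eq , qy , px)) = eE y (refl , qy)

tag : ℕ → PSet → PSet
tag i X = ｛ [ i ] ｝ ⊗ X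

pad : PSet → ℕ → PSet
pad X m = X ⊗ ｛ replicate (suc m) 0 ｝

StartsWith : ℕ → ∀ {n} → Vec ℕ n → Set
StartsWith i []      = ⊥
StartsWith i (y ∷ _) = y ≡ i

Tagged : ℕ → PSet → Set
Tagged i X = ∀ {n} (x : Vec ℕ n) → x ∈ₚ X → StartsWith i x

tag-tagged : ∀ i X → Tagged i (tag i X)
tag-tagged i X x (refl , (p , y , eq , refl , my)) = subst (StartsWith i) (sym eq) refl

tagged-⊗ : ∀ {i} X Q → Tagged i X → Tagged i (X ⊗ Q)
tagged-⊗ {i} X Q t z (refl , (x , q , eq , mx , mq)) =
  subst (StartsWith i) (sym eq) (startsWith-++ x (t x (refl , mx)))
  where
  startsWith-++ : ∀ {m} (x : Vec ℕ m) → StartsWith i x → StartsWith i (x ++ q)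
  startsWith-++ (a ∷ x) h = h

tagged-disjoint : ∀ {i j} X Y → Tagged i X → Tagged j Y → ¬ (i ≡ j) → Disjoint X Y
tagged-disjoint X Y tX tY i≢j x px py with tX x px | tY x py
tagged-disjoint X Y tX tY i≢j (a ∷ x) px py | refl | refl = i≢j refl

+-suc-swap : ∀ m n → m + suc n ≡ n + suc m
+-suc-swap m n = trans (+-suc m n) (trans (cong suc (+-comm m n)) (sym (+-suc n m)))

+-suc-leftComm : ∀ m n k → m + suc (n + k) ≡ n + suc (m + k)
+-suc-leftComm m n k = trans (+-suc m (n + k)) (trans (cong suc (x∙yz≈y∙xz m n k)) (sym (+-suc n (m + k))))

infixl 30 _⊕_
_⊕_ : PSet → PSet → PSet
A ⊕ B = tag 0 (pad A (dim B)) ∪ tag 1 (pad B (dim A))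

⊕-summands-dim : ∀ A B → dim (tag 0 (pad A (dim B))) ≡ dim (tag 1 (pad B (dim A)))
⊕-summands-dim A B = cong suc (+-suc-swap (dim A) (dim B))

⊕-summands-disjoint : ∀ A B → Disjoint (tag 0 (pad A (dim B))) (tag 1 (pad B (dim A)))
⊕-summands-disjoint A B =
  tagged-disjoint (tag 0 (pad A (dim B))) (tag 1 (pad B (dim A))) (tag-tagged 0 _) (tag-tagged 1 _) (λ ())

⊕-nonEmptyʳ : ∀ A X → NonEmpty X → NonEmpty (A ⊕ X)
⊕-nonEmptyʳ A X (n , x , x∈X) = _ , 1 ∷ (x ++ 0ᵃ) ,
  ∈-∪ʳ (tag 0 (pad A (dim X))) (tag 1 (pad X (dim A))) _ (⊕-summands-dim A X)
    (∈-⊗ ｛ [ 1 ] ｝ (pad X (dim A)) [ 1 ] (x ++ 0ᵃ) (refl , refl) (∈-⊗ X ｛ 0ᵃ ｝ x 0ᵃ x∈X (refl , refl)))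
  where
  0ᵃ = replicate (suc (dim A)) 0

⊗-nonEmpty : ∀ A B → NonEmpty A → NonEmpty B → NonEmpty (A ⊗ B)
⊗-nonEmpty A B (n , x , x∈A) (m , y , y∈B) = _ , x ++ y , ∈-⊗ A B x y x∈A y∈B

𝟙 : PSet
𝟙 = ｛ [ 0 ] ｝

module Equinumerosity (_≈_ : PSet → PSet → Set) (isE : IsEquinumerosity _≈_) where
  open IsEquinumerosity isE
  open IsEquivalence isEquivalence public using ()
    renaming (refl to ≈-refl; sym to ≈-sym; trans to ≈-trans)

  infixr 5 _⟫_
  _⟫_ : ∀ {A B C} → A ≈ B → B ≈ C → A ≈ C
  _⟫_ = ≈-trans

  ≐⇒≈ : ∀ A B → A ≐ B → A ≈ B
  ≐⇒≈ A B = ext {A} {B}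

  ≈-via-∖ : ∀ X Y X' Y' → X ≈ Y → (X ∖ Y) ≐ (X' ∖ Y') → (Y ∖ X) ≐ (Y' ∖ X') → X' ≈ Y'
  ≈-via-∖ X Y X' Y' e d₁ d₂ = Equivalence.from (E1 X' Y')
    (≈-sym (≐⇒≈ _ _ d₁) ⟫ Equivalence.to (E1 X Y) e ⟫ ≐⇒≈ _ _ d₂)

  ∪-congˡ : ∀ C X Y → dim X ≡ dim C → dim Y ≡ dim C → Disjoint X C → Disjoint Y C →
            X ≈ Y → (C ∪ X) ≈ (C ∪ Y)
  ∪-congˡ C X Y dX dY jX jY e = ≈-via-∖ X Y (C ∪ X) (C ∪ Y) e (∖-∪-cancelˡ C X Y dX jX) (∖-∪-cancelˡ C Y X dY jY)

  ∪-congʳ : ∀ C X Y → dim X ≡ dim C → dim Y ≡ dim C → Disjoint X C → Disjoint Y C →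
            X ≈ Y → (X ∪ C) ≈ (Y ∪ C)
  ∪-congʳ C X Y dX dY jX jY e =
    ≐⇒≈ _ _ (∪-comm X C dX) ⟫ ∪-congˡ C X Y dX dY jX jY e ⟫ ≐⇒≈ _ _ (∪-comm C Y (sym dY))

  ∪-cong : ∀ X Y X' Y' → dim X ≡ dim Y → dim X' ≡ dim Y → dim Y' ≡ dim Y →
           Disjoint X Y → Disjoint X' Y → Disjoint X' Y' → X ≈ X' → Y ≈ Y' → (X ∪ Y) ≈ (X' ∪ Y')
  ∪-cong X Y X' Y' dX dX' dY' jXY jX'Y jX'Y' eX eY =
    ∪-congʳ Y X X' dX dX' jXY jX'Y eX
    ⟫ ∪-congˡ X' Y Y' (sym dX') (trans dY' (sym dX')) (Disjoint-sym {X'} {Y} jX'Y) (Disjoint-sym {X'} {Y'} jX'Y') eY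

  ⊗-singletonʳ : ∀ A {h} (P : Vec ℕ (suc h)) → (A ⊗ ｛ P ｝) ≈ A
  ⊗-singletonʳ A P = proj₁ (E3 A P)

  ⊗-singletonˡ : ∀ A {h} (P : Vec ℕ (suc h)) → (｛ P ｝ ⊗ A) ≈ A
  ⊗-singletonˡ A P = proj₂ (E3 A P)

  singleton≈ : ∀ {h h'} (P : Vec ℕ (suc h)) (Q : Vec ℕ (suc h')) → ｛ P ｝ ≈ ｛ Q ｝
  singleton≈ P Q = ≈-sym (⊗-singletonʳ ｛ P ｝ Q) ⟫ ⊗-singletonˡ ｛ Q ｝ P

  tag≈ : ∀ i X → tag i X ≈ X
  tag≈ i X = ⊗-singletonˡ X [ i ]

  tag-pad≈ : ∀ i X m → tag i (pad X m) ≈ X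
  tag-pad≈ i X m = tag≈ i (pad X m) ⟫ ⊗-singletonʳ X (replicate (suc m) 0)

  -- Both unions are padded to the common dimension dim X + dim X' + 2, where
  -- the parts can be exchanged one at a time.
  tagged-∪-cong : ∀ {i j i' j'} X Y X' Y' → Tagged i X → Tagged j Y → Tagged i' X' → Tagged j' Y' →
    ¬ (i ≡ j) → ¬ (i' ≡ j) → ¬ (i' ≡ j') → dim X ≡ dim Y → dim X' ≡ dim Y' →
    X ≈ X' → Y ≈ Y' → (X ∪ Y) ≈ (X' ∪ Y')
  tagged-∪-cong (pset a P) (pset .a R) (pset b P') (pset .b R') tX tY tX' tY' i≢j i'≢j i'≢j' refl refl eX eY =
    ≈-sym (⊗-singletonʳ (X ∪ Y) 0ᵇ)
    ⟫ ≐⇒≈ _ _ (⊗-distribʳ-∪ X Y Q refl)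
    ⟫ ∪-cong (X ⊗ Q) (Y ⊗ Q) (X' ⊗ Q') (Y' ⊗ Q') refl (+-suc-swap b a) (+-suc-swap b a)
         (tagged-disjoint (X ⊗ Q) (Y ⊗ Q) (tagged-⊗ X Q tX) (tagged-⊗ Y Q tY) i≢j)
         (tagged-disjoint (X' ⊗ Q') (Y ⊗ Q) (tagged-⊗ X' Q' tX') (tagged-⊗ Y Q tY) i'≢j)
         (tagged-disjoint (X' ⊗ Q') (Y' ⊗ Q') (tagged-⊗ X' Q' tX') (tagged-⊗ Y' Q' tY') i'≢j')
         (E4 eX (singleton≈ 0ᵇ 0ᵃ)) (E4 eY (singleton≈ 0ᵇ 0ᵃ))
    ⟫ ≐⇒≈ _ _ (≐-sym {(X' ∪ Y') ⊗ Q'} {(X' ⊗ Q') ∪ (Y' ⊗ Q')} (⊗-distribʳ-∪ X' Y' Q' refl))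
    ⟫ ⊗-singletonʳ (X' ∪ Y') 0ᵃ
    where
    X = pset a P
    Y = pset a R
    X' = pset b P'
    Y' = pset b R'
    0ᵃ = replicate (suc a) 0
    0ᵇ = replicate (suc b) 0
    Q = ｛ 0ᵇ ｝
    Q' = ｛ 0ᵃ ｝

  ⊕≈∪ : ∀ X Y → dim X ≡ dim Y → Disjoint X Y → (X ⊕ Y) ≈ (X ∪ Y)
  ⊕≈∪ (pset d P) (pset .d R) refl j = ≈-sym
    ( ≈-sym (tag-pad≈ 0 (X ∪ Y) d)
    ⟫ E4 (≈-refl {｛ [ 0 ] ｝}) (≐⇒≈ _ _ (⊗-distribʳ-∪ X Y Q refl))
    ⟫ ≐⇒≈ _ _ (⊗-distribˡ-∪ PX PY ｛ [ 0 ] ｝ refl)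
    ⟫ ∪-congˡ (tag 0 PX) (tag 0 PY) (tag 1 PY) refl refl
        (⊗-disjointˡ PY PX ｛ [ 0 ] ｝ refl (⊗-disjointʳ Y X Q refl (Disjoint-sym {X} {Y} j)))
        (tagged-disjoint (tag 1 PY) (tag 0 PX) (tag-tagged 1 PY) (tag-tagged 0 PX) (λ ()))
        (tag≈ 0 PY ⟫ ≈-sym (tag≈ 1 PY)))
    where
    X = pset d P
    Y = pset d R
    Q = ｛ replicate (suc d) 0 ｝
    PX = pad X d
    PY = pad Y d

  ∪-cancelˡ : ∀ C X Y → dim X ≡ dim C → dim Y ≡ dim C → Disjoint X C → Disjoint Y C →
              (C ∪ X) ≈ (C ∪ Y) → X ≈ Y
  ∪-cancelˡ C X Y dX dY jX jY e = ≈-via-∖ (C ∪ X) (C ∪ Y) X Y e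
    (≐-sym {X ∖ Y} {(C ∪ X) ∖ (C ∪ Y)} (∖-∪-cancelˡ C X Y dX jX))
    (≐-sym {Y ∖ X} {(C ∪ Y) ∖ (C ∪ X)} (∖-∪-cancelˡ C Y X dY jY))

  tag-pad-∪-cong : ∀ {i j i' j'} A B A' B' {m n m' n'} → ¬ (i ≡ j) → ¬ (i' ≡ j) → ¬ (i' ≡ j') →
    dim A + suc m ≡ dim B + suc n → dim A' + suc m' ≡ dim B' + suc n' → A ≈ A' → B ≈ B' →
    (tag i (pad A m) ∪ tag j (pad B n)) ≈ (tag i' (pad A' m') ∪ tag j' (pad B' n'))
  tag-pad-∪-cong {i} {j} {i'} {j'} A B A' B' {m} {n} {m'} {n'} i≢j i'≢j i'≢j' d d' eA eB =
    tagged-∪-cong (tag i (pad A m)) (tag j (pad B n)) (tag i' (pad A' m')) (tag j' (pad B' n'))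
      (tag-tagged i _) (tag-tagged j _) (tag-tagged i' _) (tag-tagged j' _) i≢j i'≢j i'≢j' (cong suc d) (cong suc d')
      (tag-pad≈ i A m ⟫ eA ⟫ ≈-sym (tag-pad≈ i' A' m')) (tag-pad≈ j B n ⟫ eB ⟫ ≈-sym (tag-pad≈ j' B' n'))

  ⊕-cong : ∀ {A A' B B'} → A ≈ A' → B ≈ B' → (A ⊕ B) ≈ (A' ⊕ B')
  ⊕-cong {A} {A'} {B} {B'} =
    tag-pad-∪-cong A B A' B' (λ ()) (λ ()) (λ ()) (+-suc-swap (dim A) (dim B)) (+-suc-swap (dim A') (dim B'))

  ⊕-comm : ∀ A B → (A ⊕ B) ≈ (B ⊕ A)
  ⊕-comm A B =
    tag-pad-∪-cong A B A B (λ ()) (λ ()) (λ ()) (+-suc-swap a b) (+-suc-swap a b) ≈-refl ≈-refl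
    ⟫ ≐⇒≈ _ _ (∪-comm (tag 0 (pad A b)) (tag 2 (pad B a)) (cong suc (+-suc-swap a b)))
    ⟫ ≈-sym (tag-pad-∪-cong B A B A (λ ()) (λ ()) (λ ()) (+-suc-swap b a) (+-suc-swap b a) ≈-refl ≈-refl)
    where
    a = dim A
    b = dim B

  ⊕-identityʳ : ∀ A → (A ⊕ ∅) ≈ A
  ⊕-identityʳ A =
    ≐⇒≈ _ _ (∪-identityʳ (tag 0 (pad A 0)) (tag 1 (pad ∅ (dim A))) (⊗-isEmptyʳ _ _ (⊗-isEmptyˡ _ ∅ ∅-isEmpty)))
    ⟫ tag-pad≈ 0 A 0

  ⊕-identityˡ : ∀ A → (∅ ⊕ A) ≈ A
  ⊕-identityˡ A = ⊕-comm ∅ A ⟫ ⊕-identityʳ A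

  ⊕-assoc : ∀ A B C → ((A ⊕ B) ⊕ C) ≈ (A ⊕ (B ⊕ C))
  ⊕-assoc A B C =
    ⊕-cong A⊕B≈XA∪XB (≈-sym (tag-pad≈ 2 C _))
    ⟫ ⊕≈∪ (XA ∪ XB) XC (trans dAB dBC) (Disjoint-∪ˡ XA XB XC jAC jBC)
    ⟫ ≐⇒≈ _ _ (∪-assoc XA XB XC dAB dBC)
    ⟫ ≈-sym (⊕≈∪ XA (XB ∪ XC) dAB (Disjoint-sym {XB ∪ XC} {XA}
                (Disjoint-∪ˡ XB XC XA (Disjoint-sym {XA} {XB} jAB) (Disjoint-sym {XA} {XC} jAC))))
    ⟫ ⊕-cong (tag-pad≈ 0 A _) (≈-sym B⊕C≈XB∪XC)
    where
    a = dim A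
    b = dim B
    c = dim C
    XA = tag 0 (pad A (b + suc c))
    XB = tag 1 (pad B (a + suc c))
    XC = tag 2 (pad C (a + suc b))
    dAB : dim XA ≡ dim XB
    dAB = cong suc (+-suc-leftComm a b (suc c))
    dBC : dim XB ≡ dim XC
    dBC = cong suc (trans (+-suc-leftComm b a (suc c))
                   (trans (cong (λ k → a + suc k) (+-suc-swap b c)) (+-suc-leftComm a c (suc b))))
    jAB = tagged-disjoint XA XB (tag-tagged 0 _) (tag-tagged 1 _) (λ ())
    jAC = tagged-disjoint XA XC (tag-tagged 0 _) (tag-tagged 2 _) (λ ())
    jBC = tagged-disjoint XB XC (tag-tagged 1 _) (tag-tagged 2 _) (λ ())
    A⊕B≈XA∪XB : (A ⊕ B) ≈ (XA ∪ XB)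
    A⊕B≈XA∪XB = tag-pad-∪-cong A B A B (λ ()) (λ ()) (λ ()) (+-suc-swap a b) (+-suc-leftComm a b (suc c)) ≈-refl ≈-refl
    B⊕C≈XB∪XC : (B ⊕ C) ≈ (XB ∪ XC)
    B⊕C≈XB∪XC = ⊕-cong (≈-sym (tag-pad≈ 1 B _)) (≈-sym (tag-pad≈ 2 C _)) ⟫ ⊕≈∪ XB XC dBC jBC

  ⊕-cancelʳ : ∀ A B C → (A ⊕ C) ≈ (B ⊕ C) → A ≈ B
  ⊕-cancelʳ A B C e = ≈-sym (tag-pad≈ 0 A _) ⟫ XA≈XB ⟫ tag-pad≈ 1 B _
    where
    a = dim A
    b = dim B
    c = dim C
    XA = tag 0 (pad A (c + suc b))
    XB = tag 1 (pad B (c + suc a))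
    XC = tag 2 (pad C (a + suc b))
    dAC : a + suc (c + suc b) ≡ c + suc (a + suc b)
    dAC = +-suc-leftComm a c (suc b)
    dBC : b + suc (c + suc a) ≡ c + suc (a + suc b)
    dBC = trans (+-suc-leftComm b c (suc a)) (cong (λ k → c + suc k) (+-suc-swap b a))
    XC∪XA≈XC∪XB : (XC ∪ XA) ≈ (XC ∪ XB)
    XC∪XA≈XC∪XB =
      ≐⇒≈ _ _ (∪-comm XC XA (cong suc (sym dAC)))
      ⟫ ≈-sym (tag-pad-∪-cong A C A C (λ ()) (λ ()) (λ ()) (+-suc-swap a c) dAC ≈-refl ≈-refl)
      ⟫ e
      ⟫ ≈-sym (tag-pad-∪-cong B C B C (λ ()) (λ ()) (λ ()) dBC (+-suc-swap b c) ≈-refl ≈-refl)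
      ⟫ ≐⇒≈ _ _ (∪-comm XB XC (cong suc dBC))
    XA≈XB : XA ≈ XB
    XA≈XB = ∪-cancelˡ XC XA XB (cong suc dAC) (cong suc dBC)
      (tagged-disjoint XA XC (tag-tagged 0 _) (tag-tagged 2 _) (λ ()))
      (tagged-disjoint XB XC (tag-tagged 1 _) (tag-tagged 2 _) (λ ()))
      XC∪XA≈XC∪XB

  ⊕-cancelˡ : ∀ A B C → (C ⊕ A) ≈ (C ⊕ B) → A ≈ B
  ⊕-cancelˡ A B C e = ⊕-cancelʳ A B C (⊕-comm A C ⟫ e ⟫ ⊕-comm C B)

  ⊕-isCommutativeMonoid : IsCommutativeMonoid _≈_ _⊕_ ∅
  ⊕-isCommutativeMonoid = record
    { isMonoid = record
      { isSemigroup = record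
        { isMagma = record { isEquivalence = isEquivalence ; ∙-cong = ⊕-cong }
        ; assoc = ⊕-assoc }
      ; identity = ⊕-identityˡ , ⊕-identityʳ }
    ; comm = ⊕-comm }

  ⊕-commutativeMonoid : CommutativeMonoid (lsuc 0ℓ) 0ℓ
  ⊕-commutativeMonoid = record { isCommutativeMonoid = ⊕-isCommutativeMonoid }

  open CommutativeSemigroupProperties (CommutativeMonoid.commutativeSemigroup ⊕-commutativeMonoid)
    using (interchange; xy∙z≈xz∙y)

  ⊕-exchange : ∀ A B C D → ((A ⊕ B) ⊕ (C ⊕ D)) ≈ ((A ⊕ D) ⊕ (C ⊕ B))
  ⊕-exchange A B C D = interchange A B C D ⟫ ⊕-cong ≈-refl (⊕-comm B D) ⟫ ≈-sym (interchange A D C B)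

  ⊗-distribˡ-⊕ : ∀ A B C → (A ⊗ (B ⊕ C)) ≈ ((A ⊗ B) ⊕ (A ⊗ C))
  ⊗-distribˡ-⊕ A B C =
    ≐⇒≈ _ _ (⊗-distribˡ-∪ (tag 0 PB) (tag 1 PC) A (⊕-summands-dim B C))
    ⟫ ≈-sym (⊕≈∪ (A ⊗ tag 0 PB) (A ⊗ tag 1 PC) (cong (λ k → dim A + suc k) (⊕-summands-dim B C))
        (⊗-disjointˡ (tag 0 PB) (tag 1 PC) A (⊕-summands-dim B C) (⊕-summands-disjoint B C)))
    ⟫ ⊕-cong (E4 (≈-refl {A}) (tag-pad≈ 0 B _)) (E4 (≈-refl {A}) (tag-pad≈ 1 C _))
    where
    PB = pad B (dim C)
    PC = pad C (dim B)

  ⊗-distribʳ-⊕ : ∀ A B C → ((B ⊕ C) ⊗ A) ≈ ((B ⊗ A) ⊕ (C ⊗ A))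
  ⊗-distribʳ-⊕ A B C =
    ≐⇒≈ _ _ (⊗-distribʳ-∪ (tag 0 PB) (tag 1 PC) A (⊕-summands-dim B C))
    ⟫ ≈-sym (⊕≈∪ (tag 0 PB ⊗ A) (tag 1 PC ⊗ A) (cong (λ k → k + suc (dim A)) (⊕-summands-dim B C))
        (⊗-disjointʳ (tag 0 PB) (tag 1 PC) A (⊕-summands-dim B C) (⊕-summands-disjoint B C)))
    ⟫ ⊕-cong (E4 (tag-pad≈ 0 B _) (≈-refl {A})) (E4 (tag-pad≈ 1 C _) (≈-refl {A}))
    where
    PB = pad B (dim C)
    PC = pad C (dim B)

  ⊗-assoc : ∀ A B C → ((A ⊗ B) ⊗ C) ≈ (A ⊗ (B ⊗ C))
  ⊗-assoc A B C = ≐⇒≈ _ _ (⊗-assoc-≐ A B C)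

  ⊗-zeroʳ : ∀ A → (A ⊗ ∅) ≈ ∅
  ⊗-zeroʳ A = ≐⇒≈ _ _ (isEmpty⇒≐ {A ⊗ ∅} {∅} (⊗-isEmptyʳ A ∅ ∅-isEmpty) ∅-isEmpty)

  ⊗-zeroˡ : ∀ A → (∅ ⊗ A) ≈ ∅
  ⊗-zeroˡ A = ≐⇒≈ _ _ (isEmpty⇒≐ {∅ ⊗ A} {∅} (⊗-isEmptyˡ A ∅ ∅-isEmpty) ∅-isEmpty)

  infix 4 _⊏_ _≈⊂_

  _⊏_ : PSet → PSet → Set₁
  A ⊏ B = Σ PSet λ C → NonEmpty C × (B ≈ (A ⊕ C))

  _≈⊂_ : PSet → PSet → Set₁
  A ≈⊂ B = Σ PSet λ B' → (B' ⊂ B) × (A ≈ B')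

  -- ∅ is a proper subset of X, so alternative (c) of (E2) holds for (∅, X) and excludes (a).
  ∅≉nonEmpty : ∀ X → NonEmpty X → ¬ (∅ ≈ X)
  ∅≉nonEmpty X (n , x , x∈X) ∅≈X = proj₁ (proj₂ (proj₂ (E2 ∅ X))) (∅≈X , (∅ , ∅⊂X , ≈-refl))
    where
    ∅⊂X : ∅ ⊂ X
    ∅⊂X = (λ y y∈∅ → ⊥-elim (∅-isEmpty y y∈∅)) , (λ X⊆∅ → ∅-isEmpty x (X⊆∅ x x∈X))

  ¬nonEmpty⇒≈∅ : ∀ A → ¬ NonEmpty A → A ≈ ∅
  ¬nonEmpty⇒≈∅ A ¬ne = ≐⇒≈ A ∅ (isEmpty⇒≐ {A} {∅} (λ x x∈A → ¬ne (_ , x , x∈A)) ∅-isEmpty)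

  nonEmpty⇒∅⊏ : ∀ A → NonEmpty A → ∅ ⊏ A
  nonEmpty⇒∅⊏ A ne = A , ne , ≈-sym (⊕-identityˡ A)

  ⊏-irrefl : ∀ {A B} → A ≈ B → ¬ (A ⊏ B)
  ⊏-irrefl {A} {B} A≈B (C , ne , e) = ∅≉nonEmpty C ne (⊕-cancelˡ ∅ C A (⊕-identityʳ A ⟫ A≈B ⟫ e))

  ⊏-trans : ∀ {A B C} → A ⊏ B → B ⊏ C → A ⊏ C
  ⊏-trans {A} (X , neX , eB) (Y , neY , eC) =
    X ⊕ Y , ⊕-nonEmptyʳ X Y neY , (eC ⟫ ⊕-cong eB ≈-refl ⟫ ⊕-assoc A X Y)

  ⊏-asym : ∀ {A B} → A ⊏ B → ¬ (B ⊏ A)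
  ⊏-asym l l' = ⊏-irrefl ≈-refl (⊏-trans l l')

  ⊏-resp-≈ : ∀ {A A' B B'} → A ≈ A' → B ≈ B' → A ⊏ B → A' ⊏ B'
  ⊏-resp-≈ eA eB (C , ne , e) = C , ne , (≈-sym eB ⟫ e ⟫ ⊕-cong eA ≈-refl)

  ⊕-monoˡ-⊏ : ∀ {X Y} W → X ⊏ Y → (X ⊕ W) ⊏ (Y ⊕ W)
  ⊕-monoˡ-⊏ {X} W (C , ne , e) = C , ne , (⊕-cong e ≈-refl ⟫ xy∙z≈xz∙y X C W)

  ⊕-monoʳ-⊏ : ∀ {X Y} W → X ⊏ Y → (W ⊕ X) ⊏ (W ⊕ Y)
  ⊕-monoʳ-⊏ {X} {Y} W l = ⊏-resp-≈ (⊕-comm X W) (⊕-comm Y W) (⊕-monoˡ-⊏ W l)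

  ⊕-cancelʳ-⊏ : ∀ {X Y} W → (X ⊕ W) ⊏ (Y ⊕ W) → X ⊏ Y
  ⊕-cancelʳ-⊏ {X} {Y} W (C , ne , e) = C , ne , ⊕-cancelʳ Y (X ⊕ C) W (e ⟫ ≈-sym (xy∙z≈xz∙y X C W))

  -- The ring of formal differences: (A , B) stands for 𝔫(A) − 𝔫(B).
  Difference : Set₁
  Difference = PSet × PSet

  infix 4 _≃_
  _≃_ : Difference → Difference → Set
  (A , B) ≃ (C , D) = (A ⊕ D) ≈ (C ⊕ B)

  infixl 6 _+ᴰ_
  _+ᴰ_ : Difference → Difference → Difference
  (A , B) +ᴰ (C , D) = A ⊕ C , B ⊕ D

  -ᴰ_ : Difference → Difference
  -ᴰ (A , B) = B , A

  infixl 7 _*ᴰ_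
  _*ᴰ_ : Difference → Difference → Difference
  (A , B) *ᴰ (C , D) = (A ⊗ C) ⊕ (B ⊗ D) , (A ⊗ D) ⊕ (B ⊗ C)

  0ᴰ 1ᴰ : Difference
  0ᴰ = ∅ , ∅
  1ᴰ = 𝟙 , ∅

  embed : PSet → Difference
  embed A = A , ∅

  ≈×≈⇒≃ : ∀ {X X' Y Y'} → X ≈ X' → Y ≈ Y' → (X , Y) ≃ (X' , Y')
  ≈×≈⇒≃ eX eY = ⊕-cong eX (≈-sym eY)

  ≃-trans : ∀ {x y z} → x ≃ y → y ≃ z → x ≃ z
  ≃-trans {A , B} {C , D} {E , F} e₁ e₂ = ⊕-cancelʳ (A ⊕ F) (E ⊕ B) (C ⊕ D)
    (⊕-exchange A F C D ⟫ ⊕-cong e₁ e₂ ⟫ ⊕-comm (C ⊕ B) (E ⊕ D) ⟫ ⊕-exchange E D C B)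

  ≃-isEquivalence : IsEquivalence _≃_
  ≃-isEquivalence = record
    { refl = ≈-refl ; sym = ≈-sym ; trans = λ {x} {y} {z} → ≃-trans {x} {y} {z} }

  +ᴰ-cong : ∀ {x y u v} → x ≃ y → u ≃ v → x +ᴰ u ≃ y +ᴰ v
  +ᴰ-cong {A , B} {A' , B'} {C , D} {C' , D'} e₁ e₂ =
    interchange A C B' D' ⟫ ⊕-cong e₁ e₂ ⟫ interchange A' B C' D

  -ᴰ-cong : ∀ {x y} → x ≃ y → -ᴰ x ≃ -ᴰ y
  -ᴰ-cong {A , B} {C , D} e = ⊕-comm B C ⟫ ≈-sym e ⟫ ⊕-comm A D

  -ᴰ-inverseˡ : ∀ x → -ᴰ x +ᴰ x ≃ 0ᴰ
  -ᴰ-inverseˡ (A , B) = ⊕-identityʳ (B ⊕ A) ⟫ ⊕-comm B A ⟫ ≈-sym (⊕-identityˡ (A ⊕ B))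

  -ᴰ-inverseʳ : ∀ x → x +ᴰ -ᴰ x ≃ 0ᴰ
  -ᴰ-inverseʳ (A , B) = ⊕-identityʳ (A ⊕ B) ⟫ ⊕-comm A B ⟫ ≈-sym (⊕-identityˡ (B ⊕ A))

  *ᴰ-congʳ : ∀ {x y} u → x ≃ y → x *ᴰ u ≃ y *ᴰ u
  *ᴰ-congʳ {A , B} {A' , B'} (C , D) e =
    ⊕-cong (≈-refl {(A ⊗ C) ⊕ (B ⊗ D)}) (⊕-comm (A' ⊗ D) (B' ⊗ C))
    ⟫ interchange (A ⊗ C) (B ⊗ D) (B' ⊗ C) (A' ⊗ D)
    ⟫ ⊕-cong (≈-sym (⊗-distribʳ-⊕ C A B')) (≈-sym (⊗-distribʳ-⊕ D B A'))
    ⟫ ⊕-cong (E4 e (≈-refl {C})) (E4 e' (≈-refl {D}))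
    ⟫ ⊕-cong (⊗-distribʳ-⊕ C A' B) (⊗-distribʳ-⊕ D B' A)
    ⟫ interchange (A' ⊗ C) (B ⊗ C) (B' ⊗ D) (A ⊗ D)
    ⟫ ⊕-cong (≈-refl {(A' ⊗ C) ⊕ (B' ⊗ D)}) (⊕-comm (B ⊗ C) (A ⊗ D))
    where
    e' : (B ⊕ A') ≈ (B' ⊕ A)
    e' = ⊕-comm B A' ⟫ ≈-sym e ⟫ ⊕-comm A B'

  *ᴰ-congˡ : ∀ {x y} u → x ≃ y → u *ᴰ x ≃ u *ᴰ y
  *ᴰ-congˡ {C , D} {C' , D'} (A , B) e =
    interchange (A ⊗ C) (B ⊗ D) (A ⊗ D') (B ⊗ C')
    ⟫ ⊕-cong (≈-sym (⊗-distribˡ-⊕ A C D')) (≈-sym (⊗-distribˡ-⊕ B D C'))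
    ⟫ ⊕-cong (E4 (≈-refl {A}) e) (E4 (≈-refl {B}) e')
    ⟫ ⊕-cong (⊗-distribˡ-⊕ A C' D) (⊗-distribˡ-⊕ B D' C)
    ⟫ interchange (A ⊗ C') (A ⊗ D) (B ⊗ D') (B ⊗ C)
    where
    e' : (D ⊕ C') ≈ (D' ⊕ C)
    e' = ⊕-comm D C' ⟫ ≈-sym e ⟫ ⊕-comm C D'

  *ᴰ-cong : ∀ {x y u v} → x ≃ y → u ≃ v → x *ᴰ u ≃ y *ᴰ v
  *ᴰ-cong {x} {y} {u} {v} e₁ e₂ = ≃-trans {x *ᴰ u} {y *ᴰ u} {y *ᴰ v} (*ᴰ-congʳ u e₁) (*ᴰ-congˡ y e₂)

  *ᴰ-assoc : ∀ x y z → (x *ᴰ y) *ᴰ z ≃ x *ᴰ (y *ᴰ z)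
  *ᴰ-assoc (A , B) (C , D) (E , F) = ≈×≈⇒≃ (expand A B C D E F) (expand A B C D F E)
    where
    expand : ∀ A B C D E F →
      ((((A ⊗ C) ⊕ (B ⊗ D)) ⊗ E) ⊕ (((A ⊗ D) ⊕ (B ⊗ C)) ⊗ F))
        ≈ ((A ⊗ ((C ⊗ E) ⊕ (D ⊗ F))) ⊕ (B ⊗ ((C ⊗ F) ⊕ (D ⊗ E))))
    expand A B C D E F =
      ⊕-cong (⊗-distribʳ-⊕ E (A ⊗ C) (B ⊗ D)) (⊗-distribʳ-⊕ F (A ⊗ D) (B ⊗ C))
      ⟫ ⊕-cong (⊕-cong (⊗-assoc A C E) (⊗-assoc B D E)) (⊕-cong (⊗-assoc A D F) (⊗-assoc B C F))
      ⟫ interchange (A ⊗ (C ⊗ E)) (B ⊗ (D ⊗ E)) (A ⊗ (D ⊗ F)) (B ⊗ (C ⊗ F))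
      ⟫ ⊕-cong ≈-refl (⊕-comm (B ⊗ (D ⊗ E)) (B ⊗ (C ⊗ F)))
      ⟫ ≈-sym (⊕-cong (⊗-distribˡ-⊕ A (C ⊗ E) (D ⊗ F)) (⊗-distribˡ-⊕ B (C ⊗ F) (D ⊗ E)))

  *ᴰ-identityˡ : ∀ x → 1ᴰ *ᴰ x ≃ x
  *ᴰ-identityˡ (A , B) = ≈×≈⇒≃ (⊕-cong (⊗-singletonˡ A [ 0 ]) (⊗-zeroˡ B) ⟫ ⊕-identityʳ A)
                               (⊕-cong (⊗-singletonˡ B [ 0 ]) (⊗-zeroˡ A) ⟫ ⊕-identityʳ B)

  *ᴰ-identityʳ : ∀ x → x *ᴰ 1ᴰ ≃ x
  *ᴰ-identityʳ (A , B) = ≈×≈⇒≃ (⊕-cong (⊗-singletonʳ A [ 0 ]) (⊗-zeroʳ B) ⟫ ⊕-identityʳ A)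
                               (⊕-cong (⊗-zeroʳ A) (⊗-singletonʳ B [ 0 ]) ⟫ ⊕-identityˡ B)

  *ᴰ-distribˡ : ∀ x y z → x *ᴰ (y +ᴰ z) ≃ x *ᴰ y +ᴰ x *ᴰ z
  *ᴰ-distribˡ (A , B) (C , D) (E , F) = ≈×≈⇒≃
    (⊕-cong (⊗-distribˡ-⊕ A C E) (⊗-distribˡ-⊕ B D F) ⟫ interchange (A ⊗ C) (A ⊗ E) (B ⊗ D) (B ⊗ F))
    (⊕-cong (⊗-distribˡ-⊕ A D F) (⊗-distribˡ-⊕ B C E) ⟫ interchange (A ⊗ D) (A ⊗ F) (B ⊗ C) (B ⊗ E))

  *ᴰ-distribʳ : ∀ x y z → (y +ᴰ z) *ᴰ x ≃ y *ᴰ x +ᴰ z *ᴰ x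
  *ᴰ-distribʳ (A , B) (C , D) (E , F) = ≈×≈⇒≃
    (⊕-cong (⊗-distribʳ-⊕ A C E) (⊗-distribʳ-⊕ B D F) ⟫ interchange (C ⊗ A) (E ⊗ A) (D ⊗ B) (F ⊗ B))
    (⊕-cong (⊗-distribʳ-⊕ B C E) (⊗-distribʳ-⊕ A D F) ⟫ interchange (C ⊗ B) (E ⊗ B) (D ⊗ A) (F ⊗ A))

  differenceRing : Ring (lsuc 0ℓ) 0ℓ
  differenceRing = record
    { Carrier = Difference
    ; _≈_ = _≃_
    ; _+_ = _+ᴰ_
    ; _*_ = _*ᴰ_
    ; -_ = -ᴰ_
    ; 0# = 0ᴰ
    ; 1# = 1ᴰ
    ; isRing = record
      { +-isAbelianGroup = record
        { isGroup = record
          { isMonoid = record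
            { isSemigroup = record
              { isMagma = record
                { isEquivalence = ≃-isEquivalence
                ; ∙-cong = λ {x} {y} {u} {v} → +ᴰ-cong {x} {y} {u} {v} }
              ; assoc = λ { (A , B) (C , D) (E , F) → ≈×≈⇒≃ (⊕-assoc A C E) (⊕-assoc B D F) } }
            ; identity = (λ { (A , B) → ≈×≈⇒≃ (⊕-identityˡ A) (⊕-identityˡ B) })
                       , (λ { (A , B) → ≈×≈⇒≃ (⊕-identityʳ A) (⊕-identityʳ B) }) }
          ; inverse = -ᴰ-inverseˡ , -ᴰ-inverseʳ
          ; ⁻¹-cong = λ {x} {y} → -ᴰ-cong {x} {y} }
        ; comm = λ { (A , B) (C , D) → ≈×≈⇒≃ (⊕-comm A C) (⊕-comm B D) } }
      ; *-cong = λ {x} {y} {u} {v} → *ᴰ-cong {x} {y} {u} {v}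
      ; *-assoc = *ᴰ-assoc
      ; *-identity = *ᴰ-identityˡ , *ᴰ-identityʳ
      ; distrib = *ᴰ-distribˡ , *ᴰ-distribʳ
      }
    }

  ≈⇔embed≃ : ∀ A B → (A ≈ B) ⇔ (embed A ≃ embed B)
  ≈⇔embed≃ A B = mk⇔ (λ e → ⊕-cong e ≈-refl) (⊕-cancelʳ A B ∅)

  embed-⊕ : ∀ A B → embed (A ⊕ B) ≃ embed A +ᴰ embed B
  embed-⊕ A B = ≈×≈⇒≃ ≈-refl (≈-sym (⊕-identityˡ ∅))

  embed-⊗ : ∀ A B → embed (A ⊗ B) ≃ embed A *ᴰ embed B
  embed-⊗ A B = ≈×≈⇒≃ (≈-sym (⊕-cong ≈-refl (⊗-zeroˡ ∅) ⟫ ⊕-identityʳ (A ⊗ B)))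
                      (≈-sym (⊕-cong (⊗-zeroʳ A) (⊗-zeroˡ B) ⟫ ⊕-identityˡ ∅))

  infix 4 _⊏ᴰ_
  _⊏ᴰ_ : Difference → Difference → Set₁
  (A , B) ⊏ᴰ (C , D) = (A ⊕ D) ⊏ (C ⊕ B)

  ⊏ᴰ-irrefl : ∀ x y → x ≃ y → ¬ (x ⊏ᴰ y)
  ⊏ᴰ-irrefl (A , B) (C , D) = ⊏-irrefl

  ⊏ᴰ-trans : ∀ x y z → x ⊏ᴰ y → y ⊏ᴰ z → x ⊏ᴰ z
  ⊏ᴰ-trans (A , B) (C , D) (E , F) l₁ l₂ =
    ⊕-cancelʳ-⊏ (C ⊕ D) (⊏-resp-≈ (⊕-exchange A D C F) (⊕-comm (C ⊕ B) (E ⊕ D) ⟫ ⊕-exchange E D C B)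
      (⊏-trans (⊕-monoˡ-⊏ (C ⊕ F) l₁) (⊕-monoʳ-⊏ (C ⊕ B) l₂)))

  ⊏ᴰ-respʳ-≃ : ∀ x y z → y ≃ z → x ⊏ᴰ y → x ⊏ᴰ z
  ⊏ᴰ-respʳ-≃ (A , B) (C , D) (E , F) e l =
    ⊕-cancelʳ-⊏ (E ⊕ D) (⊏-resp-≈ (⊕-exchange A D E F) (⊕-exchange C B E F ⟫ ⊕-cong e ≈-refl ⟫ ⊕-comm (E ⊕ D) (E ⊕ B))
      (⊕-monoˡ-⊏ (E ⊕ F) l))

  ⊏ᴰ-respˡ-≃ : ∀ x y z → y ≃ z → y ⊏ᴰ x → z ⊏ᴰ x
  ⊏ᴰ-respˡ-≃ (A , B) (C , D) (E , F) e l =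
    ⊕-cancelʳ-⊏ (E ⊕ D) (⊏-resp-≈ (⊕-exchange C B E F ⟫ ⊕-cong e ≈-refl ⟫ ⊕-comm (E ⊕ D) (E ⊕ B)) (⊕-exchange A D E F)
      (⊕-monoˡ-⊏ (E ⊕ F) l))

  +ᴰ-monoˡ-⊏ᴰ : ∀ x y z → x ⊏ᴰ y → x +ᴰ z ⊏ᴰ y +ᴰ z
  +ᴰ-monoˡ-⊏ᴰ (A , B) (C , D) (E , F) l =
    ⊏-resp-≈ (interchange A D E F) (interchange C B E F) (⊕-monoˡ-⊏ (E ⊕ F) l)

  embed-⊏ᴰ : ∀ A B → (A ⊏ B) ⇔ (embed A ⊏ᴰ embed B)
  embed-⊏ᴰ A B = mk⇔ (⊏-resp-≈ (≈-sym (⊕-identityʳ A)) (≈-sym (⊕-identityʳ B)))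
                     (⊏-resp-≈ (⊕-identityʳ A) (⊕-identityʳ B))

  positive⇒embed : ∀ x → 0ᴰ ⊏ᴰ x → Σ PSet λ X → NonEmpty X × (x ≃ embed X)
  positive⇒embed (A , B) l with ⊏-resp-≈ (⊕-identityˡ B) (⊕-identityʳ A) l
  ... | X , ne , e = X , ne , (⊕-identityʳ A ⟫ e ⟫ ⊕-comm B X)

  nonEmpty⇒positive : ∀ X → NonEmpty X → 0ᴰ ⊏ᴰ embed X
  nonEmpty⇒positive X ne = Equivalence.to (embed-⊏ᴰ ∅ X) (nonEmpty⇒∅⊏ X ne)

  *ᴰ-positive : ∀ x y → 0ᴰ ⊏ᴰ x → 0ᴰ ⊏ᴰ y → 0ᴰ ⊏ᴰ x *ᴰ y
  *ᴰ-positive x y l₁ l₂ with positive⇒embed x l₁ | positive⇒embed y l₂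
  ... | X , neX , x≃X | Y , neY , y≃Y =
    ⊏ᴰ-respʳ-≃ 0ᴰ (embed (X ⊗ Y)) (x *ᴰ y) X⊗Y≃x*y (nonEmpty⇒positive (X ⊗ Y) (⊗-nonEmpty X Y neX neY))
    where
    X⊗Y≃x*y : embed (X ⊗ Y) ≃ x *ᴰ y
    X⊗Y≃x*y = ≃-trans {embed (X ⊗ Y)} {embed X *ᴰ embed Y} {x *ᴰ y} (embed-⊗ X Y)
      (≈-sym (*ᴰ-cong {x} {embed X} {y} {embed Y} x≃X y≃Y))

  ⊕-isNumSum : IsNumSum _≈_ _⊕_
  ⊕-isNumSum = ⊕-cong , ⊕≈∪

  ⊗-isNumProd : IsNumProd _≈_ _⊗_
  ⊗-isNumProd = E4 , λ A B → ≈-refl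

  isNumSum-unique : ∀ _⊕'_ → IsNumSum _≈_ _⊕'_ → ∀ A B → (A ⊕' B) ≈ (A ⊕ B)
  isNumSum-unique _⊕'_ (⊕'-cong , ⊕'≈∪) A B =
    ⊕'-cong (≈-sym (tag-pad≈ 0 A (dim B))) (≈-sym (tag-pad≈ 1 B (dim A)))
    ⟫ ⊕'≈∪ (tag 0 (pad A (dim B))) (tag 1 (pad B (dim A))) (⊕-summands-dim A B) (⊕-summands-disjoint A B)

module Classical (lem : ExcludedMiddle (lsuc 0ℓ)) (_≈_ : PSet → PSet → Set) (isE : IsEquinumerosity _≈_) where
  open IsEquinumerosity isE
  open Equinumerosity _≈_ isE

  dec : (P : Set) → Dec P
  dec P = map′ lower lift (lem {Lift (lsuc 0ℓ) P})

  -- _⊏_ and _⊏ᴰ_ quantify over point sets and so live in Set₁; excluded middle squashes them into Set.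
  ∥_∥ : Set₁ → Set
  ∥ P ∥ = True (lem {P})

  squash : ∀ {P} → P → ∥ P ∥
  squash {P} = fromWitness {a? = lem {P}}

  unsquash : ∀ {P} → ∥ P ∥ → P
  unsquash {P} = toWitness {a? = lem {P}}

  ∥∥-isStrictTotalOrder : ∀ {A : Set₁} {_~_ : A → A → Set} {_<_ : A → A → Set₁} → IsEquivalence _~_ →
    (∀ {x y} → x ~ y → ¬ (x < y)) → (∀ {x y z} → x < y → y < z → x < z) →
    (∀ {x y z} → y ~ z → x < y → x < z) → (∀ {x y z} → y ~ z → y < x → z < x) →
    (∀ x y → Tri (x < y) (x ~ y) (y < x)) → IsStrictTotalOrder _~_ (λ x y → ∥ x < y ∥)
  ∥∥-isStrictTotalOrder {_~_ = _~_} {_<_} isEq irrefl trans respʳ respˡ tri = record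
    { isStrictPartialOrder = record
      { isEquivalence = isEq
      ; irrefl = λ e l → irrefl e (unsquash l)
      ; trans = λ l₁ l₂ → squash (trans (unsquash l₁) (unsquash l₂))
      ; <-resp-≈ = (λ e l → squash (respʳ e (unsquash l))) , (λ e l → squash (respˡ e (unsquash l))) }
    ; compare = λ x y → squash-tri (tri x y) }
    where
    squash-tri : ∀ {x y} → Tri (x < y) (x ~ y) (y < x) → Tri ∥ x < y ∥ (x ~ y) ∥ y < x ∥
    squash-tri (tri< a b c) = tri< (squash a) b (λ l → c (unsquash l))
    squash-tri (tri≈ a b c) = tri≈ (λ l → a (unsquash l)) b (λ l → c (unsquash l))
    squash-tri (tri> a b c) = tri> (λ l → a (unsquash l)) b (squash c)

  ≈-split : ∀ B B' → B' ⊆ B → B ≈ (B' ⊕ (B ∖ B'))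
  ≈-split B@(pset k P) B' B'⊆B = ≐⇒≈ B (B'' ∪ D) (f , g) ⟫ ≈-sym (⊕≈∪ B'' D refl disjoint) ⟫ ⊕-cong B''≈B' ≈-refl
    where
    B'' = pset k (λ x → x ∈ₚ B')
    D = B ∖ B'
    f : B ⊆ (B'' ∪ D)
    f x (refl , m) with dec (x ∈ₚ B')
    ... | yes p = refl , inj₁ p
    ... | no np = refl , inj₂ (refl , (m , np))
    g : (B'' ∪ D) ⊆ B
    g x (refl , inj₁ p) = B'⊆B x p
    g x (refl , inj₂ (refl , (m , _))) = refl , m
    B''≈B' : B'' ≈ B'
    B''≈B' = ≐⇒≈ B'' B' ((λ { x (refl , p) → p }) , λ x p → case B'⊆B x p of λ { (refl , _) → refl , p })
    disjoint : Disjoint B'' D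
    disjoint x (refl , p) (refl , (m , np)) = np p

  ∖-nonEmpty : ∀ B B' → ¬ (B ⊆ B') → NonEmpty (B ∖ B')
  ∖-nonEmpty B@(pset k P) B' B⊈B' with dec (NonEmpty (B ∖ B'))
  ... | yes ne = ne
  ... | no ¬ne = ⊥-elim (B⊈B' B⊆B')
    where
    B⊆B' : B ⊆ B'
    B⊆B' x (refl , m) with dec (x ∈ₚ B')
    ... | yes q = q
    ... | no nq = ⊥-elim (¬ne (_ , x , (refl , (m , nq))))

  ≈⊂⇒⊏ : ∀ {A B} → A ≈⊂ B → A ⊏ B
  ≈⊂⇒⊏ {A} {B} (B' , (B'⊆B , B⊈B') , A≈B') =
    B ∖ B' , ∖-nonEmpty B B' B⊈B' , (≈-split B B' B'⊆B ⟫ ⊕-cong (≈-sym A≈B') ≈-refl)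

  ⊏⇒≈⊂ : ∀ {A B} → A ⊏ B → A ≈⊂ B
  ⊏⇒≈⊂ {A} {B} l with proj₁ (E2 A B)
  ... | inj₁ A≈B = ⊥-elim (⊏-irrefl A≈B l)
  ... | inj₂ (inj₁ (A' , A'⊂A , A'≈B)) = ⊥-elim (⊏-asym l (≈⊂⇒⊏ (A' , A'⊂A , ≈-sym A'≈B)))
  ... | inj₂ (inj₂ A≈⊂B) = A≈⊂B

  ⊏-tri : ∀ A B → Tri (A ⊏ B) (A ≈ B) (B ⊏ A)
  ⊏-tri A B with proj₁ (E2 A B)
  ... | inj₁ A≈B = tri≈ (⊏-irrefl A≈B) A≈B (⊏-irrefl (≈-sym A≈B))
  ... | inj₂ (inj₁ (A' , A'⊂A , A'≈B)) =
    let B⊏A = ≈⊂⇒⊏ (A' , A'⊂A , ≈-sym A'≈B) in tri> (λ l → ⊏-asym l B⊏A) (λ e → ⊏-irrefl (≈-sym e) B⊏A) B⊏A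
  ... | inj₂ (inj₂ A≈⊂B) =
    let A⊏B = ≈⊂⇒⊏ A≈⊂B in tri< A⊏B (λ e → ⊏-irrefl e A⊏B) (⊏-asym A⊏B)

  nonEmpty⇒¬⊏𝟙 : ∀ A → NonEmpty A → ¬ (A ⊏ 𝟙)
  nonEmpty⇒¬⊏𝟙 A@(pset k P) (n , a , (refl , a∈A)) (X , neX , 𝟙≈A⊕X) =
    ∅≉nonEmpty (A₁ ⊕ X) (⊕-nonEmptyʳ A₁ X neX) (⊕-cancelˡ ∅ (A₁ ⊕ X) 𝟙 𝟙⊕∅≈𝟙⊕A₁⊕X)
    where
    A₁ = A ∖ ｛ a ｝
    𝟙⊕∅≈𝟙⊕A₁⊕X : (𝟙 ⊕ ∅) ≈ (𝟙 ⊕ (A₁ ⊕ X))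
    𝟙⊕∅≈𝟙⊕A₁⊕X = ⊕-identityʳ 𝟙 ⟫ 𝟙≈A⊕X ⟫ ⊕-cong (≈-split A ｛ a ｝ (λ { x (refl , refl) → refl , a∈A })) ≈-refl
      ⟫ ⊕-assoc ｛ a ｝ A₁ X ⟫ ⊕-cong (singleton≈ a [ 0 ]) ≈-refl

  infix 4 _≺_ _<ᴰ_
  _≺_ : PSet → PSet → Set
  A ≺ B = ∥ A ⊏ B ∥

  _<ᴰ_ : Difference → Difference → Set
  x <ᴰ y = ∥ x ⊏ᴰ y ∥

  ≺-isStrictTotalOrder : IsStrictTotalOrder _≈_ _≺_
  ≺-isStrictTotalOrder = ∥∥-isStrictTotalOrder isEquivalence ⊏-irrefl ⊏-trans
    (⊏-resp-≈ ≈-refl) (λ e → ⊏-resp-≈ e ≈-refl) ⊏-tri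

  ≺-isNumOrder : IsNumOrder _≈_ _≺_
  ≺-isNumOrder = (λ eA eB l → squash (⊏-resp-≈ eA eB (unsquash l)))
               , (λ A B → mk⇔ (λ l → ⊏⇒≈⊂ (unsquash l)) (λ p → squash (≈⊂⇒⊏ p)))

  isNumOrder-unique : ∀ _≺'_ → IsNumOrder _≈_ _≺'_ → ∀ A B → (A ≺' B) ⇔ (A ≺ B)
  isNumOrder-unique _≺'_ (_ , ≺'⇔≈⊂) A B =
    mk⇔ (λ l → squash (≈⊂⇒⊏ (Equivalence.to (≺'⇔≈⊂ A B) l)))
        (λ l → Equivalence.from (≺'⇔≈⊂ A B) (⊏⇒≈⊂ (unsquash l)))

  ≺⇔embed<ᴰ : ∀ A B → (A ≺ B) ⇔ (embed A <ᴰ embed B)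
  ≺⇔embed<ᴰ A B = mk⇔ (λ l → squash (Equivalence.to (embed-⊏ᴰ A B) (unsquash l)))
                      (λ l → squash (Equivalence.from (embed-⊏ᴰ A B) (unsquash l)))

  <ᴰ-isDiscretelyOrderedRing : IsDiscretelyOrderedRing differenceRing _<ᴰ_
  <ᴰ-isDiscretelyOrderedRing = record
    { isStrictTotalOrder = ∥∥-isStrictTotalOrder ≃-isEquivalence
        (λ {x} {y} → ⊏ᴰ-irrefl x y) (λ {x} {y} {z} → ⊏ᴰ-trans x y z)
        (λ {x} {y} {z} → ⊏ᴰ-respʳ-≃ x y z) (λ {x} {y} {z} → ⊏ᴰ-respˡ-≃ x y z)
        (λ { (A , B) (C , D) → ⊏-tri (A ⊕ D) (C ⊕ B) })
    ; +-mono-< = λ {x} {y} z l → squash (+ᴰ-monoˡ-⊏ᴰ x y z (unsquash l))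
    ; *-pos = λ {x} {y} l₁ l₂ → squash (*ᴰ-positive x y (unsquash l₁) (unsquash l₂))
    ; discrete = discrete }
    where
    discrete : ∀ x → 0ᴰ <ᴰ x → ¬ (x <ᴰ 1ᴰ)
    discrete x l₁ l₂ with positive⇒embed x (unsquash l₁)
    ... | X , neX , x≃X = nonEmpty⇒¬⊏𝟙 X neX
      (Equivalence.from (embed-⊏ᴰ X 𝟙) (⊏ᴰ-respˡ-≃ 1ᴰ x (embed X) x≃X (unsquash l₂)))

  embed-nonNegative : ∀ A → (0ᴰ <ᴰ embed A) ⊎ (0ᴰ ≃ embed A)
  embed-nonNegative A with dec (NonEmpty A)
  ... | yes ne = inj₁ (squash (nonEmpty⇒positive A ne))
  ... | no ¬ne = inj₂ (⊕-cong (≈-sym (¬nonEmpty⇒≈∅ A ¬ne)) ≈-refl)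

  nonNegative⇒embed : ∀ x → (0ᴰ <ᴰ x) ⊎ (0ᴰ ≃ x) → Σ PSet λ A → embed A ≃ x
  nonNegative⇒embed x (inj₁ l) with positive⇒embed x (unsquash l)
  ... | X , _ , x≃X = X , ≈-sym x≃X
  nonNegative⇒embed x (inj₂ 0≃x) = ∅ , 0≃x

  embed-card : ∀ A m → HasCard A m → embed A ≃ natR differenceRing m
  embed-card A zero ([] , refl , _ , A⇔[]) = ⊕-cong (¬nonEmpty⇒≈∅ A ¬ne) ≈-refl
    where
    ¬ne : ¬ NonEmpty A
    ¬ne (_ , x , (refl , x∈A)) with Equivalence.to (A⇔[] _) x∈A
    ... | ()
  embed-card A (suc m) (x ∷ xs , len , x∉xs ∷ xs-unique , A⇔x∷xs) =
    ≃-trans {embed A} {1ᴰ +ᴰ embed A₁} {natR differenceRing (suc m)}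
      (≈×≈⇒≃ (≈-split A ｛ x ｝ x∈A ⟫ ⊕-cong (singleton≈ x [ 0 ]) ≈-refl) (≈-sym (⊕-identityˡ ∅)))
      (+ᴰ-cong {1ᴰ} {1ᴰ} {embed A₁} ≈-refl (embed-card A₁ m (xs , suc-injective len , xs-unique , A₁⇔xs)))
    where
    A₁ = A ∖ ｛ x ｝
    x∈A : ｛ x ｝ ⊆ A
    x∈A y (refl , refl) = refl , Equivalence.from (A⇔x∷xs x) (here refl)
    A₁⇔xs : ∀ y → mem A₁ y ⇔ (y ∈ xs)
    A₁⇔xs y = mk⇔ to from
      where
      to : mem A₁ y → y ∈ xs
      to (y∈A , y≢x) with Equivalence.to (A⇔x∷xs y) y∈A
      ... | here y≡x = ⊥-elim (y≢x (refl , y≡x))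
      ... | there y∈xs = y∈xs
      from : y ∈ xs → mem A₁ y
      from y∈xs = Equivalence.from (A⇔x∷xs y) (there y∈xs) , λ { (refl , y≡x) → All.lookup x∉xs y∈xs (sym y≡x) }

theorem4p2 : ExcludedMiddle (lsuc 0ℓ) →
    (_≈_ : PSet → PSet → Set) → IsEquinumerosity _≈_ →
    Σ (PSet → PSet → PSet) λ _⊕_ → Σ (PSet → PSet → PSet) λ _⊙_ → Σ (PSet → PSet → Set) λ _≺_ →
      (IsNumSum _≈_ _⊕_ × IsNumProd _≈_ _⊙_ × IsNumOrder _≈_ _≺_ × IsStrictTotalOrder _≈_ _≺_)
      × (∀ _⊕'_ → IsNumSum _≈_ _⊕'_ → ∀ A B → (A ⊕' B) ≈ (A ⊕ B))
      × (∀ _⊙'_ → IsNumProd _≈_ _⊙'_ → ∀ A B → (A ⊙' B) ≈ (A ⊙ B))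
      × (∀ _≺'_ → IsNumOrder _≈_ _≺'_ → IsStrictTotalOrder _≈_ _≺'_ → ∀ A B → (A ≺' B) ⇔ (A ≺ B))
      × Σ (Ring (lsuc 0ℓ) 0ℓ) λ R → Σ (Ring.Carrier R → Ring.Carrier R → Set) λ _<ᴿ_ →
          Σ (PSet → Ring.Carrier R) λ ι →
            IsDiscretelyOrderedRing R _<ᴿ_
            × (∀ A B → (A ≈ B) ⇔ Ring._≈_ R (ι A) (ι B))
            × (∀ A B → Ring._≈_ R (ι (A ⊕ B)) (Ring._+_ R (ι A) (ι B)))
            × (∀ A B → Ring._≈_ R (ι (A ⊙ B)) (Ring._*_ R (ι A) (ι B)))
            × (∀ A B → (A ≺ B) ⇔ (ι A <ᴿ ι B))
            × (∀ A → (Ring.0# R <ᴿ ι A) ⊎ Ring._≈_ R (Ring.0# R) (ι A))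
            × (∀ x → (Ring.0# R <ᴿ x) ⊎ Ring._≈_ R (Ring.0# R) x → Σ PSet λ A → Ring._≈_ R (ι A) x)
            × (∀ A (m : ℕ) → HasCard A m → Ring._≈_ R (ι A) (natR R m))
theorem4p2 lem _≈_ isE =
  _⊕_ , _⊗_ , _≺_
  , (⊕-isNumSum , ⊗-isNumProd , ≺-isNumOrder , ≺-isStrictTotalOrder)
  , isNumSum-unique
  , (λ _ ⊙'-isNumProd → proj₂ ⊙'-isNumProd)
  -- (3) alone determines the order.
  , (λ _≺'_ ≺'-isNumOrder _ → isNumOrder-unique _≺'_ ≺'-isNumOrder)
  , differenceRing , _<ᴰ_ , embed
  , <ᴰ-isDiscretelyOrderedRing
  , ≈⇔embed≃ , embed-⊕ , embed-⊗ , ≺⇔embed<ᴰ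
  , embed-nonNegative , nonNegative⇒embed , embed-card
  where
  open Equinumerosity _≈_ isE
  open Classical lem _≈_ isE
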